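{- Let $w$ be a fully commutative permutation, let $d$ be a descent of $w$, and suppose that $w(d+1)$ does not bump $w(d)$ during RSK insertion of $w$. Then $P(w) = P(w s_d)$. In other words, if $P(w) \neq P(ws_d)$, then either $d$ is not a descent of $w$, or $w(d+1)$ bumps $w(d)$ during RSK insertion.
   Context: A permutation is fully commutative iff it avoids $321$. $d$ is a descent of $w$ if $w(d)>w(d+1)$. $ws_d$ is obtained from $w$ by swapping the entries in positions $d,d+1$. $P(w)$ is the RSK insertion tableau, built by row-inserting $w(1),\dots,w(n)$; a value $x$ inserted into a row bumps the smallest entry of that row larger than $x$ (if any) into the next row. -}

module Defs where

open import Data.Nat using (ℕ; zero; suc; _<_; _≤_; _≤ᵇ_; _<ᵇ_)
open import Data.Bool using (Bool; true; false; if_then_else_)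
open import Data.List using (List; []; _∷_; length; map; upTo; take; foldl)
open import Data.Maybe using (Maybe; just; nothing)
open import Data.Product using (_×_; ∃; ∃-syntax; _,_)
open import Relation.Binary.PropositionalEquality using (_≡_)
open import Relation.Nullary using (¬_)
open import Data.List.Relation.Binary.Permutation.Propositional using (_↭_)

-- A permutation of [n] = {1,…,n} in one-line notation: the list
-- w(1) w(2) … w(n), which is a rearrangement of 1,2,…,n.
IsPerm : List ℕ → Set
IsPerm w = w ↭ map suc (upTo (length w))

-- 1-indexed lookup:  w ! i ≡ just (w(i))  for 1 ≤ i ≤ length w.
_!_ : List ℕ → ℕ → Maybe ℕ
[]      ! _             = nothing
(x ∷ _) ! 1             = just x
(_ ∷ _) ! 0             = nothing
(_ ∷ xs) ! suc (suc i)  = xs ! suc i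

Contains321 : List ℕ → Set
Contains321 w = ∃[ i ] ∃[ j ] ∃[ k ] ∃[ a ] ∃[ b ] ∃[ c ]
  (i < j × j < k × w ! i ≡ just a × w ! j ≡ just b × w ! k ≡ just c
   × b < a × c < b)

FullyCommutative : List ℕ → Set
FullyCommutative w = ¬ Contains321 w

IsDescent : List ℕ → ℕ → Set
IsDescent w d = ∃[ a ] ∃[ b ] (w ! d ≡ just a × w ! suc d ≡ just b × b < a)

-- w s_d : swap the entries in positions d, d+1 (1-indexed).
swapAt : ℕ → List ℕ → List ℕ
swapAt _ []                  = []
swapAt _ (x ∷ [])            = x ∷ []
swapAt 0 (x ∷ xs)            = x ∷ xs
swapAt 1 (x ∷ y ∷ xs)        = y ∷ x ∷ xs
swapAt (suc (suc d)) (x ∷ xs) = x ∷ swapAt (suc d) xs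

-- Tableaux: list of rows (top row first), each row a list of entries.
Tableau : Set
Tableau = List (List ℕ)

insertRow : ℕ → List ℕ → List ℕ × Maybe ℕ
insertRow x []       = (x ∷ [] , nothing)
insertRow x (y ∷ ys) with x <ᵇ y
... | true  = (x ∷ ys , just y)
... | false with insertRow x ys
...   | (ys' , b) = (y ∷ ys' , b)

insertT : Tableau → ℕ → Tableau
insertT []         x = (x ∷ []) ∷ []
insertT (r ∷ rows) x with insertRow x r
... | (r' , nothing) = r' ∷ rows
... | (r' , just y)  = r' ∷ insertT rows y

P : List ℕ → Tableau
P w = foldl insertT [] w

firstRowBump : Tableau → ℕ → Maybe ℕ
firstRowBump []      x = nothing
firstRowBump (r ∷ _) x with insertRow x r
... | (_ , b) = b

-- "w(d+1) bumps w(d) during RSK insertion of w": when w(d+1) is inserted into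
-- P(w(1)…w(d)), the entry it bumps (from the first row, the only row into which
-- w(d+1) itself is inserted) is w(d).
BumpsPrev : List ℕ → ℕ → Set
BumpsPrev w d = ∃[ a ] ∃[ b ]
  (w ! d ≡ just a × w ! suc d ≡ just b × firstRowBump (P (take d w)) b ≡ just a)

module Submission where

-- Avoiding 321, w cannot have an entry larger than a = w(d) before position d
-- (it would form a 321 with a > b = w(d+1)), so a sits at the end of the first
-- row of P(w(1)…w(d)).  Inserting b afterwards bumps some entry c of the first
-- row; c ≠ a by hypothesis, so c lies in the part of the row present before a
-- arrived.  Inserting b first then bumps the same c through the same lower
-- rows, and a is still the largest entry, so it is appended to the first row:
-- both orders give the same tableau.

open import Defs
open import Data.Nat using (ℕ; suc; _<_; _≤_; _<ᵇ_; s≤s; z≤n)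
open import Data.Nat.Properties using (<ᵇ⇒<; <⇒<ᵇ; <⇒≤; ≤⇒≯; ≮⇒≥; n<1+n)
open import Data.Bool using (true; false; T)
open import Data.Bool.Properties using (T-≡)
open import Data.List using (List; []; _∷_; _++_; [_]; take; foldl)
open import Data.List.Relation.Unary.All using (All; []; _∷_)
open import Data.Maybe using (just; nothing)
open import Data.Product using (_,_; proj₁)
open import Function.Bundles using (Equivalence)
open import Relation.Binary.PropositionalEquality using (_≡_; refl; sym; cong; subst)
open import Relation.Nullary using (¬_; contradiction)

<⇒<ᵇ≡true : ∀ {x y} → x < y → (x <ᵇ y) ≡ true
<⇒<ᵇ≡true x<y = Equivalence.to T-≡ (<⇒<ᵇ x<y)

≤⇒<ᵇ≡false : ∀ {x y} → y ≤ x → (x <ᵇ y) ≡ false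
≤⇒<ᵇ≡false {x} {y} y≤x with x <ᵇ y in eq
... | false = refl
... | true  = contradiction (<ᵇ⇒< x y (subst T (sym eq) _)) (≤⇒≯ y≤x)

insertRow-append : ∀ x r → All (_≤ x) r → insertRow x r ≡ (r ++ [ x ] , nothing)
insertRow-append x []       []         = refl
insertRow-append x (y ∷ ys) (y≤x ∷ ps)
  rewrite ≤⇒<ᵇ≡false y≤x | insertRow-append x ys ps = refl

insertRow-snoc-bumped : ∀ x z r r′ c → insertRow x r ≡ (r′ , just c) →
  insertRow x (r ++ [ z ]) ≡ (r′ ++ [ z ] , just c)
insertRow-snoc-bumped x z (y ∷ ys) r′ c eq with x <ᵇ y
insertRow-snoc-bumped x z (y ∷ ys) _ c refl | true = refl
... | false with insertRow x ys in eq′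
insertRow-snoc-bumped x z (y ∷ ys) _ c refl | false | (ys′ , just c)
  rewrite insertRow-snoc-bumped x z ys ys′ c eq′ = refl

insertRow-snoc-unbumped : ∀ x z r r′ → x < z → insertRow x r ≡ (r′ , nothing) →
  insertRow x (r ++ [ z ]) ≡ (r′ , just z)
insertRow-snoc-unbumped x z [] _ x<z refl rewrite <⇒<ᵇ≡true x<z = refl
insertRow-snoc-unbumped x z (y ∷ ys) r′ x<z eq with x <ᵇ y
insertRow-snoc-unbumped x z (y ∷ ys) r′ x<z () | true
... | false with insertRow x ys in eq′
insertRow-snoc-unbumped x z (y ∷ ys) _ x<z refl | false | (ys′ , nothing)
  rewrite insertRow-snoc-unbumped x z ys ys′ x<z eq′ = refl

insertRow-All : ∀ (Q : ℕ → Set) x r → All Q r → Q x → All Q (proj₁ (insertRow x r))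
insertRow-All Q x []       []       qx = qx ∷ []
insertRow-All Q x (y ∷ ys) (qy ∷ qs) qx with x <ᵇ y
... | true  = qx ∷ qs
... | false with insertRow x ys | insertRow-All Q x ys qs qx
...   | (ys′ , _) | qys′ = qy ∷ qys′

firstRow : Tableau → List ℕ
firstRow []      = []
firstRow (r ∷ _) = r

insertT-firstRow-All : ∀ (Q : ℕ → Set) T x → All Q (firstRow T) → Q x →
  All Q (firstRow (insertT T x))
insertT-firstRow-All Q []         x _  qx = qx ∷ []
insertT-firstRow-All Q (r ∷ rows) x qr qx with insertRow x r | insertRow-All Q x r qr qx
... | (r′ , nothing) | qr′ = qr′
... | (r′ , just _)  | qr′ = qr′

insertT-swap-maximal : ∀ T a b → b < a → All (_≤ a) (firstRow T) →
  ¬ firstRowBump (insertT T a) b ≡ just a →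
  insertT (insertT T a) b ≡ insertT (insertT T b) a
insertT-swap-maximal [] a b b<a _ b∤a rewrite <⇒<ᵇ≡true b<a = contradiction refl b∤a
insertT-swap-maximal (r ∷ rows) a b b<a r≤a b∤a
  rewrite insertRow-append a r r≤a with insertRow b r in eq
... | (r′ , just c)
  rewrite insertRow-snoc-bumped b a r r′ c eq
        | insertRow-append a r′
            (subst (All (_≤ a)) (cong proj₁ eq) (insertRow-All (_≤ a) b r r≤a (<⇒≤ b<a)))
        = refl
... | (r′ , nothing) rewrite insertRow-snoc-unbumped b a r r′ b<a eq = contradiction refl b∤a

!-suc : ∀ x xs i {y} → xs ! i ≡ just y → (x ∷ xs) ! suc i ≡ just y
!-suc x (_ ∷ _) (suc i) eq = eq

foldl-insertT-swapAt : ∀ T w d {a b} → w ! d ≡ just a → w ! suc d ≡ just b → b < a →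
  All (_≤ a) (firstRow T) →
  (∀ i {x} → i < d → w ! i ≡ just x → x ≤ a) →
  ¬ firstRowBump (foldl insertT T (take d w)) b ≡ just a →
  foldl insertT T w ≡ foldl insertT T (swapAt d w)
foldl-insertT-swapAt T (x ∷ y ∷ ys) 1 refl refl b<a T≤a _ b∤a =
  cong (λ U → foldl insertT U ys) (insertT-swap-maximal T x y b<a T≤a b∤a)
foldl-insertT-swapAt T (x ∷ y ∷ ys) (suc (suc d)) {a} wd wd+1 b<a T≤a prefix≤a b∤a =
  foldl-insertT-swapAt (insertT T x) (y ∷ ys) (suc d) wd wd+1 b<a
    (insertT-firstRow-All (_≤ a) T x T≤a (prefix≤a 1 (s≤s (s≤s z≤n)) refl))
    (λ i i<d+1 wi → prefix≤a (suc i) (s≤s i<d+1) (!-suc x (y ∷ ys) i wi))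
    b∤a

fullyCommutative-prefix≤descentTop : ∀ w d {a b} → FullyCommutative w →
  w ! d ≡ just a → w ! suc d ≡ just b → b < a →
  ∀ i {x} → i < d → w ! i ≡ just x → x ≤ a
fullyCommutative-prefix≤descentTop w d {a} {b} fc wd wd+1 b<a i {x} i<d wi =
  ≮⇒≥ λ a<x → fc (i , d , suc d , x , a , b , i<d , n<1+n d , wi , wd , wd+1 , a<x , b<a)

lemma5p2 : (w : List ℕ) (d : ℕ) → IsPerm w → FullyCommutative w →
    IsDescent w d → ¬ BumpsPrev w d → P w ≡ P (swapAt d w)
lemma5p2 w d _ fc (a , b , wd , wd+1 , b<a) noBump =
  foldl-insertT-swapAt [] w d wd wd+1 b<a []
    (fullyCommutative-prefix≤descentTop w d fc wd wd+1 b<a)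
    (λ bumps → noBump (a , b , wd , wd+1 , bumps))
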